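{- Let $m$ be an odd integer with $m\equiv 3\pmod 4$, and let $n\ge 1$ be an even integer. Then the digraph $\mathit{SB}(m,n)$ has no Hamiltonian cycle.
   Context: For integers $m,n\ge 1$, let $\Sigma_m=\{0,1,\dots,m-1\}$. The shift-and-save-or-bump digraph $\mathit{SB}(m,n)$ has vertex set $\Sigma_m^n$ and, from each vertex $x_1x_2\dots x_n$, exactly two arcs: the "save" arc $x_1x_2\dots x_n\to x_2\dots x_n x_1$ and the "bump" arc $x_1x_2\dots x_n\to x_2\dots x_n x_1^+$, where $x_1^+=(x_1+1)\bmod m$. (When $x_1=\dots=x_n$ the save arc is a self-loop.) A Hamiltonian cycle is a directed cycle visiting every vertex exactly once. -}

module Defs where

open import Data.Nat using (ℕ; zero; suc; _+_; _^_; NonZero)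
open import Data.Nat.DivMod using (_%_; m%n<n)
open import Data.Fin using (Fin; toℕ; fromℕ<)
open import Data.Vec using (Vec; []; _∷_; _∷ʳ_)
open import Data.Sum using (_⊎_)
open import Data.Empty using (⊥)
open import Relation.Binary.PropositionalEquality using (_≡_)
open import Function.Bundles using (Bijection)
open import Relation.Binary.PropositionalEquality using (setoid)
open import Function.Bundles using (_⤖_)

bump : {m : ℕ} → .{{NonZero m}} → Fin m → Fin m
bump {m} x = fromℕ< (m%n<n (suc (toℕ x)) m)

Vertex : ℕ → ℕ → Set
Vertex m n = Vec (Fin m) n

-- arcs of SB(m,n): save arc x₁…xₙ → x₂…xₙx₁ and bump arc x₁…xₙ → x₂…xₙx₁⁺
-- (for n = 0 there are no arcs; the theorem only concerns n ≥ 1)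
Arc : {m n : ℕ} → .{{NonZero m}} → Vertex m n → Vertex m n → Set
Arc [] y = ⊥
Arc (x ∷ xs) y = (y ≡ xs ∷ʳ x) ⊎ (y ≡ xs ∷ʳ bump x)

nextIdx : {N : ℕ} → .{{NonZero N}} → Fin N → Fin N
nextIdx {N} i = fromℕ< (m%n<n (suc (toℕ i)) N)

-- A Hamiltonian cycle: an enumeration c : Fin N ⤖ V of all vertices
-- (bijection, so every vertex is visited exactly once), N = m^n,
-- such that c i → c (i+1 mod N) is an arc for every i.
record HamiltonianCycle (m n : ℕ) .{{_ : NonZero m}} .{{_ : NonZero (m ^ n)}} : Set where
  field
    enum : Fin (m ^ n) ⤖ Vertex m n
    arcs : ∀ (i : Fin (m ^ n)) →
      Arc (Bijection.to enum i) (Bijection.to enum (nextIdx i))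

-- A Hamiltonian cycle turns the successor map π of SB(m,n) into one cycle of odd length m^n,
-- so π is an even permutation. Every arc shifts the word and then keeps or bumps the letter
-- moved to the end, so π = rotate ∘ ρ where ρ changes only the first letter, by 0 or +1.
-- As ρ is injective, on each class {a w : a ∈ Σ_m} it is the identity or the cyclic bump,
-- so ρ^m = id and ρ is even for odd m. Hence rotate must be even. But in lexicographic
-- order, rotate transposes the grid Σ_m × Σ_m^(n-1); its inversions are the pairs that are
-- increasing in one coordinate and decreasing in the other, C(m,2)·C(m^(n-1),2) of them,
-- an odd number when m ≡ 3 (mod 4) and n is even.
--
-- Parities live in 𝔽₂, represented by Bool with xor and ∧.
module Submission where

open import Defs
open import Algebra.Bundles using (CommutativeRing)
open import Data.Bool using (Bool; true; false; not; _∧_; _∨_; _xor_)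
open import Data.Bool.Properties
  using ( xor-∧-commutativeRing; xor-assoc; xor-comm; xor-same; xor-annihilates-not
        ; not-involutive; ∧-distribˡ-xor; ∧-distribʳ-xor; ∧-zeroʳ)
open import Algebra.Properties.Semiring.Sum (CommutativeRing.semiring xor-∧-commutativeRing)
  using (sum-syntax; sum-cong-≗; ∑-distrib-+; ∑-comm; ∑-permute; *-distribˡ-sum; *-distribʳ-sum)
open import Data.Empty using (⊥-elim)
open import Data.Fin using (Fin; zero; suc; toℕ; _≟_; combine; quotient; remainder; _↑ˡ_; _↑ʳ_)
open import Data.Fin.Permutation using (Permutation′; _⟨$⟩ʳ_; _⟨$⟩ˡ_; inverseˡ)
open import Data.Fin.Properties
  using (toℕ-injective; toℕ<n; toℕ-fromℕ<; toℕ-combine; remQuot-combine; combine-remQuot)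
open import Data.Nat using (ℕ; zero; suc; pred; _+_; _*_; _^_; _%_; _≤_; _<_; _<ᵇ_; _≡ᵇ_; NonZero)
open import Data.Nat.DivMod using (m<n⇒m%n≡m; [m+n]%n≡m%n; %-distribˡ-+; %-distribˡ-*; m%n%n≡m%n)
open import Data.Nat.GeneralisedArithmetic using (iterate)
open import Data.Nat.Properties
  using ( m^n≢0; <-cmp; <⇒≯; +-identityʳ; +-suc; +-comm; +-assoc; +-monoʳ-<; m≤m+n
        ; *-suc; *-assoc; *-identityˡ; *-identityʳ; *-zeroʳ; *-distribˡ-+; *-monoʳ-≤
        ; module ≤-Reasoning)
import Data.Nat.Properties as ℕ
open import Data.Product using (_,_; proj₁; proj₂)
open import Data.Sum using (_⊎_; [_,_]′)
import Data.Sum as Sum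
open import Data.Vec using (Vec; []; _∷_; _∷ʳ_; init; last; initLast)
open import Data.Vec.Properties using (init-∷ʳ; last-∷ʳ; ≡-dec)
open import Function.Base using (_∘_; id; it)
open import Function.Bundles using (Injection; Inverse; _↔_; mk↔ₛ′)
open import Function.Definitions using (Injective)
open import Function.Properties.Bijection using (Bijection⇒Inverse)
open import Function.Properties.Inverse using (↔⇒↣; ↔-sym; ↔-trans)
open import Relation.Binary.Definitions using (DecidableEquality; tri<; tri≈; tri>)
open import Relation.Binary.PropositionalEquality
open import Relation.Nullary using (¬_; yes; no)
open import Relation.Nullary.Decidable using (dec-true; dec-false)

private
  variable
    n : ℕ

↔-injective : ∀ {A B : Set} (e : A ↔ B) → Injective _≡_ _≡_ (Inverse.to e)
↔-injective e = Injection.injective (↔⇒↣ e)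

xor-cancelˡ : ∀ a b → a xor (a xor b) ≡ b
xor-cancelˡ false b = refl
xor-cancelˡ true  b = not-involutive b

xor≡false⇒≡ : ∀ {a b} → a xor b ≡ false → a ≡ b
xor≡false⇒≡ {false} {false} _ = refl
xor≡false⇒≡ {true}  {true}  _ = refl

<ᵇ-irrefl : ∀ x → (x <ᵇ x) ≡ false
<ᵇ-irrefl zero    = refl
<ᵇ-irrefl (suc x) = <ᵇ-irrefl x

≡ᵇ-refl : ∀ x → (x ≡ᵇ x) ≡ true
≡ᵇ-refl zero    = refl
≡ᵇ-refl (suc x) = ≡ᵇ-refl x

<ᵇ-swap : ∀ x y → x ≢ y → (y <ᵇ x) ≡ not (x <ᵇ y)
<ᵇ-swap zero    zero    x≢y = ⊥-elim (x≢y refl)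
<ᵇ-swap zero    (suc y) _   = refl
<ᵇ-swap (suc x) zero    _   = refl
<ᵇ-swap (suc x) (suc y) x≢y = <ᵇ-swap x y (x≢y ∘ cong suc)

<ᵇ-+ : ∀ c a b → (c + a <ᵇ c + b) ≡ (a <ᵇ b)
<ᵇ-+ zero    a b = refl
<ᵇ-+ (suc c) a b = <ᵇ-+ c a b

*-+-monoˡ-< : ∀ {k x y a} b → x < y → a < k → k * x + a < k * y + b
*-+-monoˡ-< {k} {x} {y} {a} b x<y a<k = begin-strict
  k * x + a   <⟨ +-monoʳ-< (k * x) a<k ⟩
  k * x + k   ≡⟨ +-comm (k * x) k ⟩
  k + k * x   ≡⟨ *-suc k x ⟨
  k * suc x   ≤⟨ *-monoʳ-≤ k x<y ⟩
  k * y       ≤⟨ m≤m+n (k * y) b ⟩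
  k * y + b   ∎
  where open ≤-Reasoning

-- does (x ℕ.<? y) reduces to x <ᵇ y, and does (x ℕ.≟ y) to x ≡ᵇ y.
<ᵇ-lex : ∀ {k} x y {a b} → a < k → b < k →
         (k * x + a <ᵇ k * y + b) ≡ (x <ᵇ y) ∨ ((x ≡ᵇ y) ∧ (a <ᵇ b))
<ᵇ-lex {k} x y {a} {b} a<k b<k with <-cmp x y
... | tri< x<y _ _ = trans (dec-true (_ ℕ.<? _) (*-+-monoˡ-< b x<y a<k))
                           (sym (cong (_∨ ((x ≡ᵇ y) ∧ (a <ᵇ b))) (dec-true (x ℕ.<? y) x<y)))
... | tri≈ _ refl _ = begin
  (k * x + a <ᵇ k * x + b)
    ≡⟨ <ᵇ-+ (k * x) a b ⟩
  (a <ᵇ b)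
    ≡⟨ cong₂ (λ l e → l ∨ (e ∧ (a <ᵇ b))) (<ᵇ-irrefl x) (≡ᵇ-refl x) ⟨
  (x <ᵇ x) ∨ ((x ≡ᵇ x) ∧ (a <ᵇ b)) ∎
  where open ≡-Reasoning
... | tri> _ x≢y y<x = trans (dec-false (_ ℕ.<? _) (<⇒≯ (*-+-monoˡ-< a y<x b<k)))
                             (sym (cong₂ (λ l e → l ∨ (e ∧ (a <ᵇ b)))
                                         (dec-false (x ℕ.<? y) (<⇒≯ y<x)) (dec-false (x ℕ.≟ y) x≢y)))

data Trichotomyᵇ : Bool → Bool → Bool → Set where
  less    : Trichotomyᵇ true  false false
  equal   : Trichotomyᵇ false true  false
  greater : Trichotomyᵇ false false true

<ᵇ-trichotomy : ∀ x y → Trichotomyᵇ (x <ᵇ y) (x ≡ᵇ y) (y <ᵇ x)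
<ᵇ-trichotomy zero    zero    = equal
<ᵇ-trichotomy zero    (suc y) = less
<ᵇ-trichotomy (suc x) zero    = greater
<ᵇ-trichotomy (suc x) (suc y) = <ᵇ-trichotomy x y

-- (x, t) < (x′, t′) and (t, x) > (t′, x′) lexicographically iff x < x′ and t > t′
transposed-inversion : ∀ {l e g l′ e′ g′} → Trichotomyᵇ l e g → Trichotomyᵇ l′ e′ g′ →
                       (l ∨ (e ∧ l′)) ∧ ((l ∨ (e ∧ l′)) xor (l′ ∨ (e′ ∧ l))) ≡ l ∧ g′
transposed-inversion less    less    = refl
transposed-inversion less    equal   = refl
transposed-inversion less    greater = refl
transposed-inversion equal   less    = refl
transposed-inversion equal   equal   = refl
transposed-inversion equal   greater = refl
transposed-inversion greater _       = refl

%-distribˡ-*-≡ : ∀ {x y a b} d .{{_ : NonZero d}} → x % d ≡ a → y % d ≡ b → (x * y) % d ≡ (a * b) % d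
%-distribˡ-*-≡ {x} {y} d x%d≡a y%d≡b = trans (%-distribˡ-* x y d) (cong₂ (λ u v → (u * v) % d) x%d≡a y%d≡b)

^-%2≡1 : ∀ {m} → m % 2 ≡ 1 → ∀ n → m ^ n % 2 ≡ 1
^-%2≡1     m%2≡1 zero    = refl
^-%2≡1 {m} m%2≡1 (suc n) = %-distribˡ-*-≡ {m} {m ^ n} 2 m%2≡1 (^-%2≡1 m%2≡1 n)

^-%4≡3 : ∀ {m} → m % 4 ≡ 3 → ∀ k → k % 2 ≡ 1 → m ^ k % 4 ≡ 3
^-%4≡3 {m} m%4≡3 1             _     = trans (cong (_% 4) (*-identityʳ m)) m%4≡3
^-%4≡3 {m} m%4≡3 (suc (suc k)) k-odd =
  %-distribˡ-*-≡ {m} {m * m ^ k} 4 m%4≡3 (%-distribˡ-*-≡ {m} {m ^ k} 4 m%4≡3 (^-%4≡3 m%4≡3 k k-odd))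

%4≡3⇒%2≡1 : ∀ m → m % 4 ≡ 3 → m % 2 ≡ 1
%4≡3⇒%2≡1 3                         _     = refl
%4≡3⇒%2≡1 (suc (suc (suc (suc m)))) m%4≡3 = %4≡3⇒%2≡1 m m%4≡3

suc-%2≡0⇒%2≡1 : ∀ k → suc k % 2 ≡ 0 → k % 2 ≡ 1
suc-%2≡0⇒%2≡1 1             _         = refl
suc-%2≡0⇒%2≡1 (suc (suc k)) [3+k]%2≡0 = suc-%2≡0⇒%2≡1 k [3+k]%2≡0

-- Double sums over 𝔽₂

∑∑ : (Fin n → Fin n → Bool) → Bool
∑∑ {n} G = ∑[ i < n ] ∑[ j < n ] G i j

∑∑-cong : {G H : Fin n → Fin n → Bool} → (∀ i j → G i j ≡ H i j) → ∑∑ G ≡ ∑∑ H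
∑∑-cong G≡H = sum-cong-≗ (λ i → sum-cong-≗ (G≡H i))

∑∑-xor : (G H : Fin n → Fin n → Bool) → ∑∑ (λ i j → G i j xor H i j) ≡ ∑∑ G xor ∑∑ H
∑∑-xor {n} G H = trans (sum-cong-≗ (λ i → ∑-distrib-+ (G i) (H i))) (∑-distrib-+ {n} _ _)

∑∑-permute : (G : Fin n → Fin n → Bool) (q : Permutation′ n) →
             ∑∑ G ≡ ∑∑ (λ i j → G (q ⟨$⟩ʳ i) (q ⟨$⟩ʳ j))
∑∑-permute G q = trans (∑-permute _ q) (sum-cong-≗ (λ i → ∑-permute (G (q ⟨$⟩ʳ i)) q))

-- Over 𝔽₂ the entries S i j and S j i cancel, so only the (zero) diagonal survives.
∑∑-symmetric : (S : Fin n → Fin n → Bool) → (∀ i j → S i j ≡ S j i) → (∀ i → S i i ≡ false) →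
               ∑∑ S ≡ false
∑∑-symmetric {zero}  S sym diag = refl
∑∑-symmetric {suc n} S sym diag = begin
  (S zero zero xor row) xor ∑[ i < n ] (S (suc i) zero xor ∑[ j < n ] S (suc i) (suc j))
    ≡⟨ cong₂ (λ d rest → (d xor row) xor rest) (diag zero) (∑-distrib-+ {n} _ _) ⟩
  row xor (column xor ∑∑ (λ i j → S (suc i) (suc j)))
    ≡⟨ cong₂ (λ c rest → row xor (c xor rest)) column≡row
             (∑∑-symmetric _ (λ i j → sym (suc i) (suc j)) (diag ∘ suc)) ⟩
  row xor (row xor false)
    ≡⟨ xor-cancelˡ row false ⟩
  false ∎
  where
  open ≡-Reasoning
  row column : Bool
  row    = ∑[ j < n ] S zero (suc j)
  column = ∑[ i < n ] S (suc i) zero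
  column≡row : column ≡ row
  column≡row = sum-cong-≗ (λ i → sym (suc i) zero)

sum-↑ : ∀ {a b} (f : Fin (a + b) → Bool) →
        ∑[ k < a + b ] f k ≡ ∑[ i < a ] f (i ↑ˡ b) xor ∑[ j < b ] f (a ↑ʳ j)
sum-↑ {zero}      f = refl
sum-↑ {suc a} {b} f = trans (cong (f zero xor_) (sum-↑ {a} {b} (f ∘ suc))) (sym (xor-assoc (f zero) _ _))

sum-combine : ∀ {a b} (f : Fin (a * b) → Bool) → ∑[ k < a * b ] f k ≡ ∑[ i < a ] ∑[ j < b ] f (combine i j)
sum-combine {zero}      f = refl
sum-combine {suc a} {b} f =
  trans (sum-↑ {b} {a * b} f) (cong (∑[ j < b ] f (j ↑ˡ (a * b)) xor_) (sum-combine {a} {b} (f ∘ (b ↑ʳ_))))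

∑∑-combine : ∀ {a b} (H : Fin (a * b) → Fin (a * b) → Bool) →
             ∑∑ H ≡ ∑[ x < a ] ∑[ t < b ] ∑[ x′ < a ] ∑[ t′ < b ] H (combine x t) (combine x′ t′)
∑∑-combine {a} {b} H = trans (sum-combine {a} {b} _)
  (sum-cong-≗ {a} λ x → sum-cong-≗ {b} λ t → sum-combine {a} {b} (H (combine x t)))

∑∑-∧ : ∀ {a b} (F : Fin a → Fin a → Bool) (G : Fin b → Fin b → Bool) →
       ∑[ x < a ] ∑[ x′ < a ] ∑[ t < b ] ∑[ t′ < b ] (F x x′ ∧ G t t′) ≡ ∑∑ F ∧ ∑∑ G
∑∑-∧ {a} {b} F G = sym (begin
  ∑∑ F ∧ ∑∑ G
    ≡⟨ *-distribʳ-sum {a} (∑∑ G) (λ x → ∑[ x′ < a ] F x x′) ⟩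
  ∑[ x < a ] ((∑[ x′ < a ] F x x′) ∧ ∑∑ G)
    ≡⟨ sum-cong-≗ {a} (λ x → *-distribʳ-sum (∑∑ G) (F x)) ⟩
  ∑[ x < a ] ∑[ x′ < a ] (F x x′ ∧ ∑∑ G)
    ≡⟨ sum-cong-≗ {a} (λ x → sum-cong-≗ {a} λ x′ →
         *-distribˡ-sum {b} (F x x′) (λ t → ∑[ t′ < b ] G t t′)) ⟩
  ∑[ x < a ] ∑[ x′ < a ] ∑[ t < b ] (F x x′ ∧ ∑[ t′ < b ] G t t′)
    ≡⟨ sum-cong-≗ {a} (λ x → sum-cong-≗ {a} λ x′ → sum-cong-≗ {b} λ t →
         *-distribˡ-sum (F x x′) (G t)) ⟩
  ∑[ x < a ] ∑[ x′ < a ] ∑[ t < b ] ∑[ t′ < b ] (F x x′ ∧ G t t′) ∎)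
  where open ≡-Reasoning

-- The parity of a permutation

infix 4 _≺_
_≺_ : Fin n → Fin n → Bool
i ≺ j = toℕ i <ᵇ toℕ j

≺-swap : {i j : Fin n} → i ≢ j → (j ≺ i) ≡ not (i ≺ j)
≺-swap {i = i} {j} i≢j = <ᵇ-swap (toℕ i) (toℕ j) (i≢j ∘ toℕ-injective)

flips : (Fin n → Fin n) → Fin n → Fin n → Bool
flips p i j = (i ≺ j) xor (p i ≺ p j)

upperSum : (Fin n → Fin n → Bool) → Bool
upperSum G = ∑∑ λ i j → (i ≺ j) ∧ G i j

-- the number of inversions of p, modulo 2
parity : (Fin n → Fin n) → Bool
parity p = upperSum (flips p)

-- the parity of the binomial coefficient (n choose 2)
pairParity : ℕ → Bool
pairParity n = ∑∑ {n} _≺_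

flips-diagonal : (p : Fin n → Fin n) (i : Fin n) → flips p i i ≡ false
flips-diagonal p i = cong₂ _xor_ (<ᵇ-irrefl (toℕ i)) (<ᵇ-irrefl (toℕ (p i)))

flips-symmetric : {p : Fin n → Fin n} → Injective _≡_ _≡_ p → ∀ i j → flips p i j ≡ flips p j i
flips-symmetric {p = p} p-injective i j with i ≟ j
... | yes refl = refl
... | no i≢j   = begin
  (i ≺ j) xor (p i ≺ p j)           ≡⟨ xor-annihilates-not (i ≺ j) (p i ≺ p j) ⟨
  not (i ≺ j) xor not (p i ≺ p j)   ≡⟨ cong₂ _xor_ (≺-swap i≢j) (≺-swap (i≢j ∘ p-injective)) ⟨
  (j ≺ i) xor (p j ≺ p i)           ∎
  where open ≡-Reasoning

flips-∘ : (p q : Fin n → Fin n) (i j : Fin n) → flips (p ∘ q) i j ≡ flips q i j xor flips p (q i) (q j)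
flips-∘ p q i j = sym (begin
  (a xor b) xor (b xor c)   ≡⟨ xor-assoc a b (b xor c) ⟩
  a xor (b xor (b xor c))   ≡⟨ cong (a xor_) (xor-cancelˡ b c) ⟩
  a xor c                   ∎)
  where
  open ≡-Reasoning
  a = i ≺ j
  b = q i ≺ q j
  c = p (q i) ≺ p (q j)

upperSum-xor : (G H : Fin n → Fin n → Bool) → upperSum (λ i j → G i j xor H i j) ≡ upperSum G xor upperSum H
upperSum-xor G H = trans (∑∑-cong λ i j → ∧-distribˡ-xor (i ≺ j) (G i j) (H i j))
                         (∑∑-xor (λ i j → (i ≺ j) ∧ G i j) (λ i j → (i ≺ j) ∧ H i j))

-- Reindexing moves the pairs i < j to the pairs q i < q j; the pairs whose order q flips
-- contribute a symmetric matrix, which sums to zero.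
upperSum-permute : (G : Fin n → Fin n → Bool) → (∀ i j → G i j ≡ G j i) → (q : Permutation′ n) →
                   upperSum (λ i j → G (q ⟨$⟩ʳ i) (q ⟨$⟩ʳ j)) ≡ upperSum G
upperSum-permute G G-symmetric q = xor≡false⇒≡ (begin
  upperSum Gq xor upperSum G
    ≡⟨ cong (upperSum Gq xor_) (∑∑-permute _ q) ⟩
  upperSum Gq xor ∑∑ (λ i j → (Q i ≺ Q j) ∧ Gq i j)
    ≡⟨ ∑∑-xor (λ i j → (i ≺ j) ∧ Gq i j) (λ i j → (Q i ≺ Q j) ∧ Gq i j) ⟨
  ∑∑ (λ i j → ((i ≺ j) ∧ Gq i j) xor ((Q i ≺ Q j) ∧ Gq i j))
    ≡⟨ ∑∑-cong (λ i j → ∧-distribʳ-xor (Gq i j) (i ≺ j) (Q i ≺ Q j)) ⟨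
  ∑∑ (λ i j → flips Q i j ∧ Gq i j)
    ≡⟨ ∑∑-symmetric _ (λ i j → cong₂ _∧_ (flips-symmetric (↔-injective q) i j) (G-symmetric (Q i) (Q j)))
                      (λ i → cong (_∧ Gq i i) (flips-diagonal Q i)) ⟩
  false ∎)
  where
  open ≡-Reasoning
  Q = q ⟨$⟩ʳ_
  Gq : Fin _ → Fin _ → Bool
  Gq i j = G (Q i) (Q j)

parity-∘ : {p : Fin n → Fin n} → Injective _≡_ _≡_ p → (q : Permutation′ n) →
           parity (p ∘ (q ⟨$⟩ʳ_)) ≡ parity (q ⟨$⟩ʳ_) xor parity p
parity-∘ {p = p} p-injective q = begin
  upperSum (flips (p ∘ Q))
    ≡⟨ ∑∑-cong (λ i j → cong ((i ≺ j) ∧_) (flips-∘ p Q i j)) ⟩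
  upperSum (λ i j → flips Q i j xor flips p (Q i) (Q j))
    ≡⟨ upperSum-xor (flips Q) (λ i j → flips p (Q i) (Q j)) ⟩
  parity Q xor upperSum (λ i j → flips p (Q i) (Q j))
    ≡⟨ cong (parity Q xor_) (upperSum-permute (flips p) (flips-symmetric p-injective) q) ⟩
  parity Q xor parity p ∎
  where
  open ≡-Reasoning
  Q = q ⟨$⟩ʳ_

parity-cong : {p q : Fin n → Fin n} → p ≗ q → parity p ≡ parity q
parity-cong p≗q = ∑∑-cong λ i j → cong (λ b → (i ≺ j) ∧ ((i ≺ j) xor b)) (cong₂ _≺_ (p≗q i) (p≗q j))

parity-id : parity {n} id ≡ false
parity-id {n} = begin
  upperSum (flips {n} id)
    ≡⟨ ∑∑-cong {n} (λ i j → trans (cong ((i ≺ j) ∧_) (xor-same (i ≺ j))) (∧-zeroʳ _)) ⟩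
  ∑∑ {n} (λ _ _ → false)
    ≡⟨ ∑∑-symmetric {n} (λ _ _ → false) (λ _ _ → refl) (λ _ → refl) ⟩
  false ∎
  where open ≡-Reasoning

parity-inverse : (h : Permutation′ n) → parity (h ⟨$⟩ˡ_) ≡ parity (h ⟨$⟩ʳ_)
parity-inverse {n} h = sym (xor≡false⇒≡ (begin
  parity H xor parity H⁻¹   ≡⟨ parity-∘ (↔-injective (↔-sym h)) h ⟨
  parity (H⁻¹ ∘ H)          ≡⟨ parity-cong (λ i → inverseˡ h) ⟩
  parity {n} id             ≡⟨ parity-id {n} ⟩
  false                     ∎))
  where
  open ≡-Reasoning
  H = h ⟨$⟩ʳ_
  H⁻¹ = h ⟨$⟩ˡ_

parity-conj : (h p : Permutation′ n) →
              parity ((h ⟨$⟩ˡ_) ∘ (p ⟨$⟩ʳ_) ∘ (h ⟨$⟩ʳ_)) ≡ parity (p ⟨$⟩ʳ_)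
parity-conj h p = begin
  parity ((H⁻¹ ∘ P) ∘ H)                   ≡⟨ parity-∘ (↔-injective p ∘ ↔-injective (↔-sym h)) h ⟩
  parity H xor parity (H⁻¹ ∘ P)            ≡⟨ cong (parity H xor_) (parity-∘ (↔-injective (↔-sym h)) p) ⟩
  parity H xor (parity P xor parity H⁻¹)   ≡⟨ cong (λ x → parity H xor (parity P xor x)) (parity-inverse h) ⟩
  parity H xor (parity P xor parity H)     ≡⟨ cong (parity H xor_) (xor-comm (parity P) (parity H)) ⟩
  parity H xor (parity H xor parity P)     ≡⟨ xor-cancelˡ (parity H) (parity P) ⟩
  parity P                                 ∎
  where
  open ≡-Reasoning
  H = h ⟨$⟩ʳ_
  H⁻¹ = h ⟨$⟩ˡ_
  P = p ⟨$⟩ʳ_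

-- The grid Fin a × Fin b, enumerated row by row, is re-enumerated column by column.
module _ {a b : ℕ} (p : Fin (a * b) → Fin (a * b))
         (p-transposes : ∀ (x : Fin a) (t : Fin b) → toℕ (p (combine x t)) ≡ a * toℕ t + toℕ x) where

  transpose-inversion : (x : Fin a) (t : Fin b) (x′ : Fin a) (t′ : Fin b) →
    (combine x t ≺ combine x′ t′) ∧ flips p (combine x t) (combine x′ t′) ≡ (x ≺ x′) ∧ (t′ ≺ t)
  transpose-inversion x t x′ t′ = begin
    (c ≺ c′) ∧ ((c ≺ c′) xor (p c ≺ p c′))
      ≡⟨ cong₂ (λ u v → u ∧ (u xor v)) row-order column-order ⟩
    (x≺x′ ∨ (x≡x′ ∧ t≺t′)) ∧ ((x≺x′ ∨ (x≡x′ ∧ t≺t′)) xor (t≺t′ ∨ (t≡t′ ∧ x≺x′)))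
      ≡⟨ transposed-inversion (<ᵇ-trichotomy (toℕ x) (toℕ x′)) (<ᵇ-trichotomy (toℕ t) (toℕ t′)) ⟩
    x≺x′ ∧ (t′ ≺ t) ∎
    where
    open ≡-Reasoning
    c = combine x t
    c′ = combine x′ t′
    x≺x′ = x ≺ x′
    t≺t′ = t ≺ t′
    x≡x′ = toℕ x ≡ᵇ toℕ x′
    t≡t′ = toℕ t ≡ᵇ toℕ t′
    row-order : (c ≺ c′) ≡ x≺x′ ∨ (x≡x′ ∧ t≺t′)
    row-order = trans (cong₂ _<ᵇ_ (toℕ-combine x t) (toℕ-combine x′ t′))
                      (<ᵇ-lex (toℕ x) (toℕ x′) (toℕ<n t) (toℕ<n t′))
    column-order : (p c ≺ p c′) ≡ t≺t′ ∨ (t≡t′ ∧ x≺x′)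
    column-order = trans (cong₂ _<ᵇ_ (p-transposes x t) (p-transposes x′ t′))
                         (<ᵇ-lex (toℕ t) (toℕ t′) (toℕ<n x) (toℕ<n x′))

  parity-transpose : parity p ≡ pairParity a ∧ pairParity b
  parity-transpose = begin
    parity p
      ≡⟨ ∑∑-combine {a} {b} (λ c c′ → (c ≺ c′) ∧ flips p c c′) ⟩
    ∑[ x < a ] ∑[ t < b ] ∑[ x′ < a ] ∑[ t′ < b ]
      ((combine x t ≺ combine x′ t′) ∧ flips p (combine x t) (combine x′ t′))
      ≡⟨ sum-cong-≗ {a} (λ x → sum-cong-≗ {b} λ t → sum-cong-≗ {a} λ x′ → sum-cong-≗ {b} λ t′ →
                                transpose-inversion x t x′ t′) ⟩
    ∑[ x < a ] ∑[ t < b ] ∑[ x′ < a ] ∑[ t′ < b ] ((x ≺ x′) ∧ (t′ ≺ t))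
      ≡⟨ sum-cong-≗ {a} (λ x → ∑-comm {b} {a} (λ t x′ → ∑[ t′ < b ] ((x ≺ x′) ∧ (t′ ≺ t)))) ⟩
    ∑[ x < a ] ∑[ x′ < a ] ∑[ t < b ] ∑[ t′ < b ] ((x ≺ x′) ∧ (t′ ≺ t))
      ≡⟨ ∑∑-∧ {a} {b} _≺_ (λ t t′ → t′ ≺ t) ⟩
    pairParity a ∧ ∑[ t < b ] ∑[ t′ < b ] (t′ ≺ t)
      ≡⟨ cong (pairParity a ∧_) (∑-comm {b} {b} (λ t t′ → t′ ≺ t)) ⟩
    pairParity a ∧ pairParity b ∎
    where open ≡-Reasoning

-- pairParity (suc n) computes to (∑[ j < n ] true) xor pairParity n.
pairParity-+4 : ∀ n → pairParity (4 + n) ≡ pairParity n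
pairParity-+4 n with ∑[ j < n ] true | pairParity n
... | false | false = refl
... | false | true  = refl
... | true  | false = refl
... | true  | true  = refl

pairParity-%4≡3 : ∀ n → n % 4 ≡ 3 → pairParity n ≡ true
pairParity-%4≡3 3                         _     = refl
pairParity-%4≡3 (suc (suc (suc (suc n)))) n%4≡3 = trans (pairParity-+4 n) (pairParity-%4≡3 n n%4≡3)

module _ {A : Set} {f : A → A} where

  iterate-injective : Injective _≡_ _≡_ f → ∀ k → Injective _≡_ _≡_ (λ x → iterate f x k)
  iterate-injective f-injective zero    eq = eq
  iterate-injective f-injective (suc k) eq = f-injective (iterate-injective f-injective k eq)

  iterate-commute : ∀ x k → f (iterate f x k) ≡ iterate f (f x) k
  iterate-commute x zero    = refl
  iterate-commute x (suc k) = iterate-commute (f x) k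

  iterate-fixed : ∀ {x} → f x ≡ x → ∀ k → iterate f x k ≡ x
  iterate-fixed fx≡x zero    = refl
  iterate-fixed fx≡x (suc k) = trans (cong (λ y → iterate f y k) fx≡x) (iterate-fixed fx≡x k)

  iterate-pred : ∀ k .{{_ : NonZero k}} x → iterate f (f x) (pred k) ≡ iterate f x k
  iterate-pred (suc k) x = refl

  finiteOrder⇒↔ : ∀ k .{{_ : NonZero k}} → (∀ x → iterate f x k ≡ x) → A ↔ A
  finiteOrder⇒↔ k order = mk↔ₛ′ f (λ x → iterate f x (pred k))
    (λ x → trans (iterate-commute x (pred k)) (f⁻¹∘f x)) f⁻¹∘f
    where
    f⁻¹∘f : ∀ x → iterate f (f x) (pred k) ≡ x
    f⁻¹∘f x = trans (iterate-pred k x) (order x)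

module _ {A : Set} (_≟ᴬ_ : DecidableEquality A) {s f : A → A}
         (f-injective : Injective _≡_ _≡_ f) (f-step : ∀ x → f x ≡ x ⊎ f x ≡ s x) where

  -- by injectivity, a point moved by f has its image moved by f as well
  iterate-moving : ∀ {x} → f x ≢ x → ∀ k → iterate f x k ≡ iterate s x k
  iterate-moving     fx≢x zero    = refl
  iterate-moving {x} fx≢x (suc k) = begin
    iterate f (f x) k   ≡⟨ iterate-moving (fx≢x ∘ f-injective) k ⟩
    iterate s (f x) k   ≡⟨ cong (λ y → iterate s y k) fx≡sx ⟩
    iterate s (s x) k   ∎
    where
    open ≡-Reasoning
    fx≡sx : f x ≡ s x
    fx≡sx = [ (λ fx≡x → ⊥-elim (fx≢x fx≡x)) , id ]′ (f-step x)

  stayOrStep-order : ∀ k → (∀ x → iterate s x k ≡ x) → ∀ x → iterate f x k ≡ x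
  stayOrStep-order k s-order x with f x ≟ᴬ x
  ... | yes fx≡x = iterate-fixed fx≡x k
  ... | no  fx≢x = trans (iterate-moving fx≢x k) (s-order x)

parity-iterate-suc : (P : Permutation′ n) → let p = P ⟨$⟩ʳ_ in ∀ j →
                     parity (λ i → iterate p i (suc j)) ≡ parity p xor parity (λ i → iterate p i j)
parity-iterate-suc P j = parity-∘ (iterate-injective (↔-injective P) j) P

parity-oddOrder : (p : Fin n → Fin n) (k : ℕ) → (∀ i → iterate p i k ≡ i) → k % 2 ≡ 1 → parity p ≡ false
parity-oddOrder {n} p (suc k) order k-odd = begin
  parity p                            ≡⟨ odd-power (suc k) k-odd ⟨
  parity (λ i → iterate p i (suc k))  ≡⟨ parity-cong order ⟩
  parity {n} id                       ≡⟨ parity-id {n} ⟩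
  false                               ∎
  where
  open ≡-Reasoning
  step = parity-iterate-suc (finiteOrder⇒↔ (suc k) order)
  odd-power : ∀ j → j % 2 ≡ 1 → parity (λ i → iterate p i j) ≡ parity p
  odd-power 1             _     = refl
  odd-power (suc (suc j)) j-odd = begin
    parity (λ i → iterate p i (suc (suc j)))                   ≡⟨ step (suc j) ⟩
    parity p xor parity (λ i → iterate p i (suc j))            ≡⟨ cong (parity p xor_) (step j) ⟩
    parity p xor (parity p xor parity (λ i → iterate p i j))   ≡⟨ xor-cancelˡ (parity p) _ ⟩
    parity (λ i → iterate p i j)                               ≡⟨ odd-power j j-odd ⟩
    parity p                                                   ∎

module _ .{{_ : NonZero n}} where

  toℕ-iterate-nextIdx : (i : Fin n) (j : ℕ) → toℕ (iterate nextIdx i j) ≡ (toℕ i + j) % n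
  toℕ-iterate-nextIdx i zero    = sym (trans (cong (_% n) (+-identityʳ (toℕ i))) (m<n⇒m%n≡m (toℕ<n i)))
  toℕ-iterate-nextIdx i (suc j) = begin
    toℕ (iterate nextIdx (nextIdx i) j)   ≡⟨ toℕ-iterate-nextIdx (nextIdx i) j ⟩
    (toℕ (nextIdx i) + j) % n             ≡⟨ cong (λ x → (x + j) % n) (toℕ-fromℕ< _) ⟩
    (suc (toℕ i) % n + j) % n             ≡⟨ %-distribˡ-+ (suc (toℕ i) % n) j n ⟩
    (suc (toℕ i) % n % n + j % n) % n     ≡⟨ cong (λ x → (x + j % n) % n) (m%n%n≡m%n (suc (toℕ i)) n) ⟩
    (suc (toℕ i) % n + j % n) % n         ≡⟨ %-distribˡ-+ (suc (toℕ i)) j n ⟨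
    (suc (toℕ i) + j) % n                 ≡⟨ cong (_% n) (+-suc (toℕ i) j) ⟨
    (toℕ i + suc j) % n                   ∎
    where open ≡-Reasoning

  iterate-nextIdx : (i : Fin n) → iterate nextIdx i n ≡ i
  iterate-nextIdx i = toℕ-injective (begin
    toℕ (iterate nextIdx i n)   ≡⟨ toℕ-iterate-nextIdx i n ⟩
    (toℕ i + n) % n             ≡⟨ [m+n]%n≡m%n (toℕ i) n ⟩
    toℕ i % n                   ≡⟨ m<n⇒m%n≡m (toℕ<n i) ⟩
    toℕ i                       ∎)
    where open ≡-Reasoning

  nextIdx-injective : Injective _≡_ _≡_ (nextIdx {n})
  nextIdx-injective = ↔-injective (finiteOrder⇒↔ n iterate-nextIdx)

module _ {A : Set} where
  open Inverse

  parityOf : Fin n ↔ A → (A → A) → Bool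
  parityOf e f = parity (from e ∘ f ∘ to e)

  parityOf-cong : (e : Fin n ↔ A) {f g : A → A} → f ≗ g → parityOf e f ≡ parityOf e g
  parityOf-cong e f≗g = parity-cong (cong (from e) ∘ f≗g ∘ to e)

  iterate-conj : (e : Fin n ↔ A) (f : A → A) → ∀ i k →
                 iterate (from e ∘ f ∘ to e) i k ≡ from e (iterate f (to e i) k)
  iterate-conj e f i zero    = sym (strictlyInverseʳ e i)
  iterate-conj e f i (suc k) = trans (iterate-conj e f _ k)
                                     (cong (λ x → from e (iterate f x k)) (strictlyInverseˡ e _))

  parityOf-oddOrder : (e : Fin n ↔ A) {f : A → A} (k : ℕ) → (∀ x → iterate f x k ≡ x) → k % 2 ≡ 1 →
                      parityOf e f ≡ false
  parityOf-oddOrder e {f} k order = parity-oddOrder _ k λ i → begin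
    iterate (from e ∘ f ∘ to e) i k   ≡⟨ iterate-conj e f i k ⟩
    from e (iterate f (to e i) k)     ≡⟨ cong (from e) (order (to e i)) ⟩
    from e (to e i)                   ≡⟨ strictlyInverseʳ e i ⟩
    i                                 ∎
    where open ≡-Reasoning

  parityOf-∘ : (e : Fin n ↔ A) {f : A → A} → Injective _≡_ _≡_ f → (σ : A ↔ A) →
               parityOf e (f ∘ to σ) ≡ parityOf e (to σ) xor parityOf e f
  parityOf-∘ e {f} f-injective σ = begin
    parity (from e ∘ f ∘ to σ ∘ to e)
      ≡⟨ parity-cong (λ i → cong (from e ∘ f) (strictlyInverseˡ e _)) ⟨
    parity ((from e ∘ f ∘ to e) ∘ (from e ∘ to σ ∘ to e))
      ≡⟨ parity-∘ (↔-injective e ∘ f-injective ∘ ↔-injective (↔-sym e))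
                  (↔-trans (↔-trans e σ) (↔-sym e)) ⟩
    parityOf e (to σ) xor parityOf e f ∎
    where open ≡-Reasoning

  parityOf-enumeration : (e₁ e₂ : Fin n ↔ A) (σ : A ↔ A) → parityOf e₁ (to σ) ≡ parityOf e₂ (to σ)
  parityOf-enumeration e₁ e₂ σ = begin
    parity (from e₁ ∘ to σ ∘ to e₁)
      ≡⟨ parity-cong (λ i → cong (from e₁)
                       (trans (strictlyInverseˡ e₂ _) (cong (to σ) (strictlyInverseˡ e₂ _)))) ⟨
    parity ((h ⟨$⟩ˡ_) ∘ (σ′ ⟨$⟩ʳ_) ∘ (h ⟨$⟩ʳ_))
      ≡⟨ parity-conj h σ′ ⟩
    parity (from e₂ ∘ to σ ∘ to e₂) ∎
    where
    open ≡-Reasoning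
    h = ↔-trans e₁ (↔-sym e₂)
    σ′ = ↔-trans (↔-trans e₂ σ) (↔-sym e₂)

-- Words

module _ {A : Set} where

  rotate : Vec A (suc n) → Vec A (suc n)
  rotate (x ∷ xs) = xs ∷ʳ x

  rotate⁻¹ : Vec A (suc n) → Vec A (suc n)
  rotate⁻¹ xs = last xs ∷ init xs

  rotate⁻¹-∷ʳ : (xs : Vec A n) (x : A) → rotate⁻¹ (xs ∷ʳ x) ≡ x ∷ xs
  rotate⁻¹-∷ʳ xs x = cong₂ _∷_ (last-∷ʳ x xs) (init-∷ʳ x xs)

  rotation : Vec A (suc n) ↔ Vec A (suc n)
  rotation = mk↔ₛ′ rotate rotate⁻¹ (λ xs → sym (proj₂ (proj₂ (initLast xs))))
                                   (λ { (x ∷ xs) → rotate⁻¹-∷ʳ xs x })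

module _ {m : ℕ} where

  index : Vec (Fin m) n → Fin (m ^ n)
  index []      = zero
  index (a ∷ v) = combine a (index v)

  unindex : Fin (m ^ n) → Vec (Fin m) n
  unindex {zero}  _ = []
  unindex {suc n} k = quotient {m} (m ^ n) k ∷ unindex (remainder {m} (m ^ n) k)

  unindex-index : (v : Vec (Fin m) n) → unindex (index v) ≡ v
  unindex-index         []      = refl
  unindex-index {suc n} (a ∷ v) =
    cong₂ _∷_ (cong proj₁ (remQuot-combine a (index v)))
              (trans (cong (unindex {n} ∘ proj₂) (remQuot-combine a (index v))) (unindex-index v))

  index-unindex : (k : Fin (m ^ n)) → index {n} (unindex k) ≡ k
  index-unindex {zero}  zero = refl
  index-unindex {suc n} k    =
    trans (cong (combine (quotient {m} (m ^ n) k)) (index-unindex {n} (remainder {m} (m ^ n) k)))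
          (combine-remQuot {m} (m ^ n) k)

  lexicographic : Fin (m ^ n) ↔ Vec (Fin m) n
  lexicographic {n} = mk↔ₛ′ (unindex {n}) index unindex-index (index-unindex {n})

  toℕ-index-∷ʳ : (v : Vec (Fin m) n) (a : Fin m) → toℕ (index (v ∷ʳ a)) ≡ m * toℕ (index v) + toℕ a
  toℕ-index-∷ʳ [] a = begin
    toℕ (combine a zero)   ≡⟨ toℕ-combine a zero ⟩
    1 * toℕ a + 0          ≡⟨ +-identityʳ (1 * toℕ a) ⟩
    1 * toℕ a              ≡⟨ *-identityˡ (toℕ a) ⟩
    toℕ a                  ≡⟨ cong (_+ toℕ a) (*-zeroʳ m) ⟨
    m * 0 + toℕ a          ∎
    where open ≡-Reasoning
  toℕ-index-∷ʳ {suc n} (x ∷ v) a = begin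
    toℕ (combine x (index (v ∷ʳ a)))                ≡⟨ toℕ-combine x (index (v ∷ʳ a)) ⟩
    m * m ^ n * toℕ x + toℕ (index (v ∷ʳ a))        ≡⟨ cong (m * m ^ n * toℕ x +_) (toℕ-index-∷ʳ v a) ⟩
    m * m ^ n * toℕ x + (m * i + toℕ a)             ≡⟨ cong (_+ (m * i + toℕ a)) (*-assoc m (m ^ n) (toℕ x)) ⟩
    m * (m ^ n * toℕ x) + (m * i + toℕ a)           ≡⟨ +-assoc (m * (m ^ n * toℕ x)) (m * i) (toℕ a) ⟨
    m * (m ^ n * toℕ x) + m * i + toℕ a             ≡⟨ cong (_+ toℕ a) (*-distribˡ-+ m (m ^ n * toℕ x) i) ⟨
    m * (m ^ n * toℕ x + i) + toℕ a                 ≡⟨ cong (λ y → m * y + toℕ a) (toℕ-combine x (index v)) ⟨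
    m * toℕ (combine x (index v)) + toℕ a           ∎
    where
    open ≡-Reasoning
    i = toℕ (index v)

  -- In lexicographic order, rotation transposes the grid of (first letter, rest).
  parityOf-rotate : ∀ k → parityOf (lexicographic {suc k}) rotate ≡ pairParity m ∧ pairParity (m ^ k)
  parityOf-rotate k = parity-transpose (index ∘ rotate ∘ unindex {suc k}) λ x t → begin
    toℕ (index (rotate (unindex {suc k} (combine x t))))
      ≡⟨ cong (λ (a , r) → toℕ (index (unindex {k} r ∷ʳ a))) (remQuot-combine {m} {m ^ k} x t) ⟩
    toℕ (index (unindex {k} t ∷ʳ x))
      ≡⟨ toℕ-index-∷ʳ (unindex {k} t) x ⟩
    m * toℕ (index (unindex {k} t)) + toℕ x
      ≡⟨ cong (λ r → m * toℕ r + toℕ x) (index-unindex {k} t) ⟩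
    m * toℕ t + toℕ x ∎
    where open ≡-Reasoning

module _ {m : ℕ} .{{_ : NonZero m}} where

  bumpHead : Vec (Fin m) (suc n) → Vec (Fin m) (suc n)
  bumpHead (a ∷ w) = bump a ∷ w

  iterate-bumpHead : ∀ (a : Fin m) (w : Vec (Fin m) n) j → iterate bumpHead (a ∷ w) j ≡ iterate bump a j ∷ w
  iterate-bumpHead a w zero    = refl
  iterate-bumpHead a w (suc j) = iterate-bumpHead (bump a) w j

  -- bump is nextIdx on Fin m
  bumpHead-order : (v : Vec (Fin m) (suc n)) → iterate bumpHead v m ≡ v
  bumpHead-order (a ∷ w) = trans (iterate-bumpHead a w m) (cong (_∷ w) (iterate-nextIdx a))

-- Hamiltonian cycles

module _ {m k : ℕ} .{{_ : NonZero m}} (hc : HamiltonianCycle m (suc k) {{it}} {{m^n≢0 m (suc k)}}) where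
  open Inverse

  private
    instance
      m^[1+k]≢0 : NonZero (m ^ suc k)
      m^[1+k]≢0 = m^n≢0 m (suc k)

    c : Fin (m ^ suc k) ↔ Vertex m (suc k)
    c = Bijection⇒Inverse (HamiltonianCycle.enum hc)

    successor : Vertex m (suc k) → Vertex m (suc k)
    successor = to c ∘ nextIdx ∘ from c

    successor-arc : ∀ v → Arc v (successor v)
    successor-arc v = subst (λ u → Arc u (successor v)) (strictlyInverseˡ c v) (HamiltonianCycle.arcs hc (from c v))

    ρ : Vertex m (suc k) → Vertex m (suc k)
    ρ = rotate⁻¹ ∘ successor

    ρ-step : ∀ v → ρ v ≡ v ⊎ ρ v ≡ bumpHead v
    ρ-step (a ∷ w) = Sum.map (λ eq → trans (cong rotate⁻¹ eq) (rotate⁻¹-∷ʳ w a))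
                             (λ eq → trans (cong rotate⁻¹ eq) (rotate⁻¹-∷ʳ w (bump a)))
                             (successor-arc (a ∷ w))

    ρ-injective : Injective _≡_ _≡_ ρ
    ρ-injective = ↔-injective (↔-sym c) ∘ nextIdx-injective ∘ ↔-injective c ∘ ↔-injective (↔-sym rotation)

    ρ-order : ∀ v → iterate ρ v m ≡ v
    ρ-order = stayOrStep-order (≡-dec _≟_) ρ-injective ρ-step m bumpHead-order

  hamiltonian⇒rotate-even : m % 2 ≡ 1 → pairParity m ∧ pairParity (m ^ k) ≡ false
  hamiltonian⇒rotate-even m-odd = begin
    pairParity m ∧ pairParity (m ^ k)
      ≡⟨ parityOf-rotate k ⟨
    parityOf L rotate
      ≡⟨ parityOf-enumeration L c rotation ⟩
    parityOf c rotate
      ≡⟨ cong (_xor parityOf c rotate) (parityOf-oddOrder c m ρ-order m-odd) ⟨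
    parityOf c ρ xor parityOf c rotate
      ≡⟨ parityOf-∘ c (↔-injective rotation) (finiteOrder⇒↔ m ρ-order) ⟨
    parityOf c (rotate ∘ ρ)
      ≡⟨ parityOf-cong c (λ v → strictlyInverseˡ rotation (successor v)) ⟩
    parityOf c successor
      ≡⟨ parity-cong (λ i → trans (strictlyInverseʳ c _) (cong nextIdx (strictlyInverseʳ c i))) ⟩
    parity (nextIdx {m ^ suc k})
      ≡⟨ parity-oddOrder nextIdx (m ^ suc k) (iterate-nextIdx {m ^ suc k}) (^-%2≡1 {m} m-odd (suc k)) ⟩
    false ∎
    where
    open ≡-Reasoning
    L = lexicographic {m} {suc k}

theorem5p1 : (m n : ℕ) → .{{_ : NonZero m}} → m % 4 ≡ 3 → 1 ≤ n → n % 2 ≡ 0 →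
    ¬ HamiltonianCycle m n {{it}} {{m^n≢0 m n}}
theorem5p1 m zero    _     () _
theorem5p1 m (suc k) m%4≡3 _  n%2≡0 hc = true≢false (begin
  true
    ≡⟨ cong₂ _∧_ (pairParity-%4≡3 m m%4≡3) (pairParity-%4≡3 (m ^ k) m^k%4≡3) ⟨
  pairParity m ∧ pairParity (m ^ k)
    ≡⟨ hamiltonian⇒rotate-even hc (%4≡3⇒%2≡1 m m%4≡3) ⟩
  false ∎)
  where
  open ≡-Reasoning
  m^k%4≡3 : m ^ k % 4 ≡ 3
  m^k%4≡3 = ^-%4≡3 m%4≡3 k (suc-%2≡0⇒%2≡1 k n%2≡0)
  true≢false : true ≢ false
  true≢false ()
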